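{- Let $G=(V,E)$ be a simple graph, let $(F,M)$ be a valid partition of $G$ with $k$ colors, and let $H=(V,M)$ be its surplus graph. Suppose a path in $H$ is given by edges $(e_1,\dots,e_l)$ where $e_1,e_l\in M_i$ for the same color $i$ (and $e_1\ne e_l$). Then $(F,M)$ can be modified into a valid partition $(F',M')$ of $G$ with $|M'|<|M|$.
   Context: A pseudoforest is a graph in which each connected component contains at most one cycle. For a pseudoforest $(V,P)$, a $P$-matching is a set obtained by choosing exactly one edge on each cycle of $(V,P)$. A valid partition of $G=(V,E)$ with $k$ colors is a partition $E=F\,\dot\cup\, M$ with $F=F_1\dot\cup\cdots\dot\cup F_k$ and $M=M_1\dot\cup\cdots\dot\cup M_k$ such that each $F_i$ is a forest, $P_i=F_i\cup M_i$ is a pseudoforest, and $M_i$ is a $P_i$-matching, for $i=1,\dots,k$. Edges of $F_i$ and $M_i$ have color $i$. The surplus graph of $(F,M)$ is $H=(V,M)$. -}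

module Defs where

open import Data.Nat using (ℕ; zero; suc; _+_; _≤_; _<_)
open import Data.Fin using (Fin; zero; suc; inject₁; fromℕ; _≟_)
open import Relation.Nullary.Decidable using (⌊_⌋)
open import Data.Bool using (Bool; true; false; if_then_else_)
open import Data.Product using (Σ; ∃; _×_; _,_; proj₁; proj₂)
open import Data.Sum using (_⊎_)
open import Relation.Binary.PropositionalEquality using (_≡_; _≢_; subst; sym)
open import Relation.Nullary using (¬_)
open import Function.Definitions using (Injective)

record Graph : Set where
  field
    n    : ℕ
    m    : ℕ
    ends : Fin m → Fin n × Fin n

open Graph public

Joins : (G : Graph) → Fin (m G) → Fin (n G) → Fin (n G) → Set
Joins G e u v = ends G e ≡ (u , v) ⊎ ends G e ≡ (v , u)

Simple : Graph → Set
Simple G =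
  (∀ e → proj₁ (ends G e) ≢ proj₂ (ends G e)) ×
  (∀ e e' u v → Joins G e u v → Joins G e' u v → e ≡ e')

-- a subset of the edges (a spanning subgraph (V, S))
EdgeSet : Graph → Set
EdgeSet G = Fin (m G) → Bool

_∈ₑ_ : ∀ {k} → Fin k → (Fin k → Bool) → Set
e ∈ₑ S = S e ≡ true

record Walk (G : Graph) (S : EdgeSet G) : Set where
  field
    len : ℕ
    vs  : Fin (suc len) → Fin (n G)
    es  : Fin len → Fin (m G)
    inS : ∀ j → es j ∈ₑ S
    joins : ∀ j → Joins G (es j) (vs (inject₁ j)) (vs (suc j))

record Path (G : Graph) (S : EdgeSet G) : Set where
  field
    walk : Walk G S
  open Walk walk public
  field
    distinct : Injective _≡_ _≡_ vs

FirstLast : {G : Graph} {S : EdgeSet G} → Path G S → Fin (m G) → Fin (m G) → Set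
FirstLast π e f =
  Σ ℕ λ l → Σ (Path.len π ≡ suc l) λ eq →
    Path.es π (subst Fin (sym eq) zero) ≡ e ×
    Path.es π (subst Fin (sym eq) (fromℕ l)) ≡ f

Connected : (G : Graph) → EdgeSet G → Fin (n G) → Fin (n G) → Set
Connected G S u v =
  Σ (Walk G S) λ w → Walk.vs w zero ≡ u × Walk.vs w (fromℕ (Walk.len w)) ≡ v

record Cycle (G : Graph) (S : EdgeSet G) : Set where
  field
    l   : ℕ
    long : 2 ≤ l
    vs  : Fin (suc l) → Fin (n G)
    es  : Fin (suc l) → Fin (m G)
    vs-distinct : Injective _≡_ _≡_ vs
    es-distinct : Injective _≡_ _≡_ es
    inS : ∀ j → es j ∈ₑ S
    joins : ∀ (j : Fin l) → Joins G (es (inject₁ j)) (vs (inject₁ j)) (vs (suc j))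
    closes : Joins G (es (fromℕ l)) (vs (fromℕ l)) (vs zero)

OnCycle : {G : Graph} {S : EdgeSet G} → Cycle G S → Fin (m G) → Set
OnCycle C e = ∃ λ j → Cycle.es C j ≡ e

Forest : (G : Graph) → EdgeSet G → Set
Forest G S = ¬ Cycle G S

-- each connected component contains at most one cycle: any two cycles
-- lying in the same component have the same edge set
Pseudoforest : (G : Graph) → EdgeSet G → Set
Pseudoforest G S =
  ∀ (C D : Cycle G S) →
  Connected G S (Cycle.vs C zero) (Cycle.vs D zero) →
  ∀ e → (OnCycle C e → OnCycle D e) × (OnCycle D e → OnCycle C e)

PMatching : (G : Graph) → (P M : EdgeSet G) → Set
PMatching G P M =
  (∀ e → e ∈ₑ M → e ∈ₑ P) ×
  (∀ (C : Cycle G P) →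
     (∃ λ j → Cycle.es C j ∈ₑ M) ×
     (∀ j j' → Cycle.es C j ∈ₑ M → Cycle.es C j' ∈ₑ M → j ≡ j')) ×
  (∀ e → e ∈ₑ M → Σ (Cycle G P) λ C → OnCycle C e)

-- Partitions E = F ∪ M into k colours.
-- Each edge gets a colour col e and a flag inM e (true: in M, false: in F).

record Partition (G : Graph) (k : ℕ) : Set where
  field
    col : Fin (m G) → Fin k
    inM : Fin (m G) → Bool

module _ {G : Graph} {k : ℕ} (p : Partition G k) where
  open Partition p

  Fᵢ : Fin k → EdgeSet G
  Fᵢ i e = if inM e then false else ⌊ col e ≟ i ⌋

  Mᵢ : Fin k → EdgeSet G
  Mᵢ i e = if inM e then ⌊ col e ≟ i ⌋ else false

  Pᵢ : Fin k → EdgeSet G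
  Pᵢ i e = ⌊ col e ≟ i ⌋

  Mset : EdgeSet G
  Mset = inM

Valid : {G : Graph} {k : ℕ} → Partition G k → Set
Valid {G} {k} p =
  ∀ (i : Fin k) → Forest G (Fᵢ p i) × Pseudoforest G (Pᵢ p i)
                  × PMatching G (Pᵢ p i) (Mᵢ p i)

count : ∀ {m} → (Fin m → Bool) → ℕ
count {zero}  f = 0
count {suc m} f = (if f zero then 1 else 0) + count (λ e → f (suc e))

sizeM : {G : Graph} {k : ℕ} → Partition G k → ℕ
sizeM p = count (Mset p)

{-# OPTIONS --safe #-}
-- Two adjacent surplus edges never share a colour
-- (they would be two surplus edges in one component of a pseudoforest), so e₂ has a colour
-- c ≠ i.  Give e₁ colour c and e₂ colour i: class c trades its surplus edge e₂ for e₁, and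
-- class i trades e₁ for e₂.  Trading a surplus edge a for an adjacent edge b keeps a class
-- valid when b is made surplus exactly if it closes a cycle in the class minus a: the
-- component of a then contains at most the one new cycle, through b.  If either traded-in
-- edge closes no cycle, |M| drops; otherwise M is unchanged and e₂ … e_l is a shorter
-- path whose end edges both lie in M_i.
module Submission where

open import Defs
open import Data.Bool as Bool using (Bool; true; false; if_then_else_)
open import Data.Empty using (⊥-elim)
open import Data.Fin using (Fin; zero; suc; inject₁; fromℕ; toℕ; _≟_)
open import Data.Fin.Properties
  using (fromℕ≢inject₁; suc-injective; toℕ-inject₁; inject₁-injective; any?; pigeonhole)
open import Data.Nat using (ℕ; zero; suc; _≤_; _<_; z≤n; s≤s)
import Data.Nat.Properties as ℕ
open import Data.Product using (Σ; ∃; _×_; _,_; proj₁; proj₂; swap)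
open import Data.Product.Properties using (,-injective)
open import Data.Sum as Sum using (_⊎_; inj₁; inj₂)
open import Data.Unit using (⊤; tt)
open import Data.Vec.Functional using (updateAt)
open import Data.Vec.Functional.Properties using (updateAt-updates; updateAt-minimal)
open import Function using (_∘_; const; case_of_)
open import Function.Definitions using (Injective)
open import Level using (0ℓ)
open import Relation.Binary.Construct.Closure.ReflexiveTransitive as Star using (Star; ε; _◅_; _◅◅_)
open import Relation.Binary.PropositionalEquality
open import Relation.Nullary using (¬_; Dec; yes; no; does)
open import Relation.Nullary.Decidable
  using (⌊_⌋; _×-dec_; _⊎-dec_; ¬?; dec-true; dec-false; isYes≗does)
open import Relation.Unary using (Pred; _⊆_; _∪_; _∩_; Decidable)

false≢true : false ≢ true
false≢true ()

data InitOrLast (l : ℕ) : Fin (suc l) → Set where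
  init : (k : Fin l) → InitOrLast l (inject₁ k)
  last : InitOrLast l (fromℕ l)

initOrLast : ∀ l (j : Fin (suc l)) → InitOrLast l j
initOrLast zero    zero = last
initOrLast (suc l) zero = init zero
initOrLast (suc l) (suc j) with initOrLast l j
... | init k = init (suc k)
... | last   = last

snoc : ∀ {A : Set} {l} → (Fin l → A) → A → Fin (suc l) → A
snoc {l = zero}  f a _       = a
snoc {l = suc l} f a zero    = f zero
snoc {l = suc l} f a (suc j) = snoc (λ i → f (suc i)) a j

snoc-init : ∀ {A : Set} {l} (f : Fin l → A) a (k : Fin l) → snoc f a (inject₁ k) ≡ f k
snoc-init {l = suc l} f a zero    = refl
snoc-init {l = suc l} f a (suc k) = snoc-init (λ i → f (suc i)) a k

snoc-last : ∀ {A : Set} l (f : Fin l → A) a → snoc f a (fromℕ l) ≡ a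
snoc-last zero    f a = refl
snoc-last (suc l) f a = snoc-last l (λ i → f (suc i)) a

module Routes (G : Graph) where

  V : Set
  V = Fin (n G)

  E : Set
  E = Fin (m G)

  joins-sym : ∀ {e u v} → Joins G e u v → Joins G e v u
  joins-sym (inj₁ p) = inj₂ p
  joins-sym (inj₂ p) = inj₁ p

  joins-ends : ∀ {e u v u' v'} → Joins G e u v → Joins G e u' v' →
               (u ≡ u' × v ≡ v') ⊎ (u ≡ v' × v ≡ u')
  joins-ends (inj₁ p) (inj₁ q) = inj₁ (,-injective (trans (sym p) q))
  joins-ends (inj₁ p) (inj₂ q) = inj₂ (,-injective (trans (sym p) q))
  joins-ends (inj₂ p) (inj₁ q) = inj₂ (swap (,-injective (trans (sym p) q)))
  joins-ends (inj₂ p) (inj₂ q) = inj₁ (swap (,-injective (trans (sym p) q)))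

  joins? : ∀ e u v → Dec (Joins G e u v)
  joins? e u v = ends≟ (ends G e) (u , v) ⊎-dec ends≟ (ends G e) (v , u)
    where
    ends≟ : (a b : V × V) → Dec (a ≡ b)
    ends≟ (a₁ , a₂) (b₁ , b₂) with a₁ ≟ b₁ | a₂ ≟ b₂
    ... | yes refl | yes refl = yes refl
    ... | no ≢₁    | _        = no λ eq → ≢₁ (cong proj₁ eq)
    ... | yes _    | no ≢₂    = no λ eq → ≢₂ (cong proj₂ eq)

  Link : Pred E 0ℓ → V → V → Set
  Link Q x y = Σ E λ e → Q e × Joins G e x y

  Route : Pred E 0ℓ → V → V → Set
  Route Q = Star (Link Q)

  reverseRoute : ∀ {Q x y} → Route Q x y → Route Q y x
  reverseRoute = Star.reverse λ (e , q , j) → e , q , joins-sym j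

  mapRoute : ∀ {Q Q'} → Q ⊆ Q' → ∀ {x y} → Route Q x y → Route Q' x y
  mapRoute Q⊆Q' = Star.map λ (e , q , j) → e , Q⊆Q' q , j

  bypass : ∀ {Q Q' b x w} → Q' ⊆ Q ∪ (_≡ b) → Joins G b x w → Route Q x w →
           ∀ {u v} → Route Q' u v → Route Q u v
  bypass sub jb r ε = ε
  bypass sub jb r ((e , q , j) ◅ rest) with sub q
  ... | inj₁ q' = (e , q' , j) ◅ bypass sub jb r rest
  ... | inj₂ refl with joins-ends j jb
  ...   | inj₁ (refl , refl) = r ◅◅ bypass sub jb r rest
  ...   | inj₂ (refl , refl) = reverseRoute r ◅◅ bypass sub jb r rest

  -- Cut at the first and the last traversal of b.
  split : ∀ {Q Q' b x w} → Q' ⊆ Q ∪ (_≡ b) → Joins G b x w → ∀ {u v} → Route Q' u v →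
          Route Q u v ⊎ (Route Q u x × Route Q w v) ⊎ (Route Q u w × Route Q x v)
  split sub jb ε = inj₁ ε
  split sub jb ((e , q , j) ◅ r) with sub q | split sub jb r
  ... | inj₁ q' | inj₁ r'              = inj₁ ((e , q' , j) ◅ r')
  ... | inj₁ q' | inj₂ (inj₁ (r₁ , r₂)) = inj₂ (inj₁ ((e , q' , j) ◅ r₁ , r₂))
  ... | inj₁ q' | inj₂ (inj₂ (r₁ , r₂)) = inj₂ (inj₂ ((e , q' , j) ◅ r₁ , r₂))
  ... | inj₂ refl | rest with joins-ends j jb | rest
  ...   | inj₁ (refl , refl) | inj₁ r'              = inj₂ (inj₁ (ε , r'))
  ...   | inj₁ (refl , refl) | inj₂ (inj₁ (_ , r₂)) = inj₂ (inj₁ (ε , r₂))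
  ...   | inj₁ (refl , refl) | inj₂ (inj₂ (_ , r₂)) = inj₁ r₂
  ...   | inj₂ (refl , refl) | inj₁ r'              = inj₂ (inj₂ (ε , r'))
  ...   | inj₂ (refl , refl) | inj₂ (inj₁ (_ , r₂)) = inj₁ r₂
  ...   | inj₂ (refl , refl) | inj₂ (inj₂ (_ , r₂)) = inj₂ (inj₂ (ε , r₂))

  length : ∀ {Q x y} → Route Q x y → ℕ
  length ε       = 0
  length (_ ◅ r) = suc (length r)

  vertex : ∀ {Q x y} (r : Route Q x y) → Fin (suc (length r)) → V
  vertex {x = x} ε       _       = x
  vertex {x = x} (_ ◅ r) zero    = x
  vertex         (_ ◅ r) (suc t) = vertex r t

  edge : ∀ {Q x y} (r : Route Q x y) → Fin (length r) → E
  edge ((e , _) ◅ r) zero    = e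
  edge (_       ◅ r) (suc t) = edge r t

  edge-∈ : ∀ {Q x y} (r : Route Q x y) t → Q (edge r t)
  edge-∈ ((_ , q , _) ◅ r) zero    = q
  edge-∈ (_           ◅ r) (suc t) = edge-∈ r t

  edge-joins : ∀ {Q x y} (r : Route Q x y) t →
               Joins G (edge r t) (vertex r (inject₁ t)) (vertex r (suc t))
  edge-joins ((_ , _ , j) ◅ ε)       zero    = j
  edge-joins ((_ , _ , j) ◅ (_ ◅ _)) zero    = j
  edge-joins (_           ◅ r)       (suc t) = edge-joins r t

  vertex-first : ∀ {Q x y} (r : Route Q x y) → vertex r zero ≡ x
  vertex-first ε       = refl
  vertex-first (_ ◅ _) = refl

  vertex-last : ∀ {Q x y} (r : Route Q x y) → vertex r (fromℕ (length r)) ≡ y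
  vertex-last ε       = refl
  vertex-last (_ ◅ r) = vertex-last r

  route⇒connected : ∀ {S x y} → Route (_∈ₑ S) x y → Connected G S x y
  route⇒connected r =
    record { len = length r ; vs = vertex r ; es = edge r ; inS = edge-∈ r ; joins = edge-joins r }
    , vertex-first r , vertex-last r

  EdgeBefore EdgeFrom : ∀ {len} → (Fin len → E) → Fin (suc len) → Pred E 0ℓ
  EdgeBefore es t e = ∃ λ s → es s ≡ e × toℕ s < toℕ t
  EdgeFrom   es t e = ∃ λ s → es s ≡ e × toℕ t ≤ toℕ s

  prefix : ∀ {len} (vs : Fin (suc len) → V) (es : Fin len → E) →
           (∀ t → Joins G (es t) (vs (inject₁ t)) (vs (suc t))) →
           ∀ t → Route (EdgeBefore es t) (vs zero) (vs t)
  prefix vs es joins zero = ε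
  prefix {suc len} vs es joins (suc t) =
    (es zero , (zero , refl , s≤s z≤n) , joins zero)
    ◅ mapRoute (λ (s , eq , s<t) → suc s , eq , s≤s s<t)
        (prefix (λ s → vs (suc s)) (λ s → es (suc s)) (λ s → joins (suc s)) t)

  suffix : ∀ {len} (vs : Fin (suc len) → V) (es : Fin len → E) →
           (∀ t → Joins G (es t) (vs (inject₁ t)) (vs (suc t))) →
           ∀ t → Route (EdgeFrom es t) (vs t) (vs (fromℕ len))
  suffix {zero} vs es joins zero = ε
  suffix {suc len} vs es joins zero =
    (es zero , (zero , refl , z≤n) , joins zero)
    ◅ mapRoute (λ (s , eq , _) → suc s , eq , z≤n)
        (suffix (λ s → vs (suc s)) (λ s → es (suc s)) (λ s → joins (suc s)) zero)
  suffix {suc len} vs es joins (suc t) =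
    mapRoute (λ (s , eq , t≤s) → suc s , eq , s≤s t≤s)
      (suffix (λ s → vs (suc s)) (λ s → es (suc s)) (λ s → joins (suc s)) t)

  connected⇒route : ∀ {S x y} → Connected G S x y → Route (_∈ₑ S) x y
  connected⇒route (w , refl , refl) =
    mapRoute (λ { (s , refl , _) → Walk.inS w s })
      (prefix (Walk.vs w) (Walk.es w) (Walk.joins w) (fromℕ (Walk.len w)))

  Distinct : ∀ {Q x y} → Route Q x y → Set
  Distinct ε               = ⊤
  Distinct {x = x} (_ ◅ r) = (∀ t → vertex r t ≢ x) × Distinct r

  dropUntil : ∀ {Q y z} (r : Route Q y z) t → Route Q (vertex r t) z
  dropUntil ε       zero    = ε
  dropUntil (l ◅ r) zero    = l ◅ r
  dropUntil (_ ◅ r) (suc t) = dropUntil r t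

  dropUntil-distinct : ∀ {Q y z} (r : Route Q y z) t → Distinct r → Distinct (dropUntil r t)
  dropUntil-distinct ε       zero    _       = tt
  dropUntil-distinct (_ ◅ _) zero    d       = d
  dropUntil-distinct (_ ◅ r) (suc t) (_ , d) = dropUntil-distinct r t d

  shortcut : ∀ {Q x y} → Route Q x y → Σ (Route Q x y) Distinct
  shortcut ε = ε , tt
  shortcut {x = x} (l ◅ r) with shortcut r
  ... | r' , d with any? (λ t → vertex r' t ≟ x)
  ...   | yes (t , refl) = dropUntil r' t , dropUntil-distinct r' t d
  ...   | no fresh       = l ◅ r' , (λ t eq → fresh (t , eq)) , d

  vertex-injective : ∀ {Q x y} (r : Route Q x y) → Distinct r → Injective _≡_ _≡_ (vertex r)
  vertex-injective ε       _          {zero}  {zero}  _  = refl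
  vertex-injective (_ ◅ _) _          {zero}  {zero}  _  = refl
  vertex-injective (_ ◅ _) (fresh , _) {zero}  {suc t} eq = ⊥-elim (fresh t (sym eq))
  vertex-injective (_ ◅ _) (fresh , _) {suc s} {zero}  eq = ⊥-elim (fresh s eq)
  vertex-injective (_ ◅ r) (_ , d)     {suc s} {suc t} eq = cong suc (vertex-injective r d eq)

  edge-injective : ∀ {Q x y} (r : Route Q x y) → Distinct r → Injective _≡_ _≡_ (edge r)
  edge-injective r d {s} {t} eq
    with joins-ends (edge-joins r s) (subst (λ e → Joins G e _ _) (sym eq) (edge-joins r t))
  ... | inj₁ (same , _)       = inject₁-injective (vertex-injective r d same)
  ... | inj₂ (s≡t+1 , s+1≡t) = ⊥-elim (ℕ.<-asym t<s s<t)
    where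
    t<s : toℕ t < toℕ s
    t<s = ℕ.≤-reflexive (trans (sym (cong toℕ (vertex-injective r d s≡t+1))) (toℕ-inject₁ s))
    s<t : toℕ s < toℕ t
    s<t = ℕ.≤-reflexive (trans (cong toℕ (vertex-injective r d s+1≡t)) (toℕ-inject₁ t))

  length-distinct : ∀ {Q x y} (r : Route Q x y) → Distinct r → length r < n G
  length-distinct r d = ℕ.≮⇒≥ λ n<len+1 →
    let (s , t , s<t , eq) = pigeonhole n<len+1 (vertex r)
    in ℕ.<-irrefl (cong toℕ (vertex-injective r d eq)) s<t

  module _ {Q : Pred E 0ℓ} (Q? : Decidable Q) (y : V) where

    private
      ReachesWithin : ℕ → V → Set
      ReachesWithin zero    u = u ≡ y
      ReachesWithin (suc t) u = u ≡ y ⊎ ∃ λ e → ∃ λ z → Q e × Joins G e u z × ReachesWithin t z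

      within? : ∀ t u → Dec (ReachesWithin t u)
      within? zero    u = u ≟ y
      within? (suc t) u =
        (u ≟ y) ⊎-dec any? λ e → any? λ z → Q? e ×-dec joins? e u z ×-dec within? t z

      sound : ∀ {t u} → ReachesWithin t u → Route Q u y
      sound {zero}  refl                          = ε
      sound {suc t} (inj₁ refl)                   = ε
      sound {suc t} (inj₂ (e , z , q , j , rest)) = (e , q , j) ◅ sound rest

      complete : ∀ {t u} (r : Route Q u y) → length r ≤ t → ReachesWithin t u
      complete {zero}  ε                 _         = refl
      complete {suc t} ε                 _         = inj₁ refl
      complete {suc t} ((e , q , j) ◅ r) (s≤s len≤t) = inj₂ (e , _ , q , j , complete r len≤t)

    reachable? : ∀ u → Dec (Route Q u y)
    reachable? u with within? (n G) u
    ... | yes r   = yes (sound r)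
    ... | no none = no λ r →
      let (r' , d) = shortcut r in none (complete r' (ℕ.<⇒≤ (length-distinct r' d)))

module CycleRoutes (G : Graph) {S : EdgeSet G} (C : Cycle G S) where
  open Routes G
  open Cycle C

  onCycle-∈ : OnCycle C ⊆ (_∈ₑ S)
  onCycle-∈ (j , refl) = inS j

  toVertex : ∀ t → Route (OnCycle C) (vs zero) (vs t)
  toVertex t = mapRoute (λ { (s , eq , _) → inject₁ s , eq }) (prefix vs (λ s → es (inject₁ s)) joins t)

  toEnd : ∀ {h u v} j → es j ≡ h → Joins G h u v → Route (OnCycle C) (vs zero) u
  toEnd j eq jh with initOrLast l j
  toEnd .(inject₁ k) refl jh | init k with joins-ends jh (joins k)
  ... | inj₁ (refl , _) = toVertex (inject₁ k)
  ... | inj₂ (refl , _) = toVertex (suc k)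
  toEnd .(fromℕ l) refl jh | last with joins-ends jh closes
  ... | inj₁ (refl , _) = toVertex (fromℕ l)
  ... | inj₂ (refl , _) = ε

  Avoiding : Fin (suc l) → Pred (Fin (m G)) 0ℓ
  Avoiding j = OnCycle C ∩ (_≢ es j)

  private
    inject₁-differs : ∀ {s k : Fin l} → toℕ s ≢ toℕ k → es (inject₁ s) ≢ es (inject₁ k)
    inject₁-differs {s} {k} s≢k eq =
      s≢k (trans (sym (toℕ-inject₁ s)) (trans (cong toℕ (es-distinct eq)) (toℕ-inject₁ k)))

    last-differs : ∀ (k : Fin l) → es (fromℕ l) ≢ es (inject₁ k)
    last-differs k eq = fromℕ≢inject₁ (es-distinct eq)

    around-canonical : ∀ j → ∃ λ u → ∃ λ v → Joins G (es j) u v × Route (Avoiding j) u v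
    around-canonical j with initOrLast l j
    ... | init k = vs (suc k) , vs (inject₁ k) , joins-sym (joins k) ,
          mapRoute (λ { (s , refl , k<s) → (inject₁ s , refl) , inject₁-differs (ℕ.>⇒≢ k<s) })
            (suffix vs (λ s → es (inject₁ s)) joins (suc k))
          ◅◅ (es (fromℕ l) , ((fromℕ l , refl) , last-differs k) , closes)
          ◅ mapRoute (λ { (s , refl , s<k) →
                (inject₁ s , refl) , inject₁-differs (ℕ.<⇒≢ (subst (toℕ s <_) (toℕ-inject₁ k) s<k)) })
              (prefix vs (λ s → es (inject₁ s)) joins (inject₁ k))
    ... | last = vs zero , vs (fromℕ l) , joins-sym closes ,
          mapRoute (λ { (s , refl , _) → (inject₁ s , refl) , last-differs s ∘ sym })
            (prefix vs (λ s → es (inject₁ s)) joins (fromℕ l))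

  around : ∀ j {u v} → Joins G (es j) u v → Route (Avoiding j) u v
  around j jh with around-canonical j
  ... | u , v , j₀ , r with joins-ends jh j₀
  ... | inj₁ (refl , refl) = r
  ... | inj₂ (refl , refl) = reverseRoute r

module Cycles (G : Graph) where
  open Routes G

  cycle-within : ∀ {S S'} (C : Cycle G S) → (∀ j → Cycle.es C j ∈ₑ S') → Cycle G S'
  cycle-within C inS' = record
    { l = l ; long = long ; vs = vs ; es = es ; vs-distinct = vs-distinct
    ; es-distinct = es-distinct ; inS = inS' ; joins = joins ; closes = closes }
    where open Cycle C

  cycle-⊆ : ∀ {S S'} → (_∈ₑ S) ⊆ (_∈ₑ S') → Cycle G S → Cycle G S'
  cycle-⊆ S⊆S' C = cycle-within C (λ j → S⊆S' (Cycle.inS C j))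

  joins-distinct : Simple G → ∀ {e u v} → Joins G e u v → u ≢ v
  joins-distinct (noLoop , _) (inj₁ eq) refl = noLoop _ (trans (cong proj₁ eq) (sym (cong proj₂ eq)))
  joins-distinct (noLoop , _) (inj₂ eq) refl = noLoop _ (trans (cong proj₁ eq) (sym (cong proj₂ eq)))

  closeCycle : Simple G → ∀ (S : EdgeSet G) {g x y} → g ∈ₑ S → Joins G g x y →
               Route ((_∈ₑ S) ∩ (_≢ g)) y x → Σ (Cycle G S) λ C → OnCycle C g
  closeCycle simple S {g} {x} {y} g∈S jg r with shortcut r
  ... | p , d = cycle , fromℕ (length p) , snoc-last (length p) (edge p) g
    where
    L : ℕ
    L = length p

    es : Fin (suc L) → Fin (m G)
    es = snoc (edge p) g

    -- No loops rules out length 0, no parallel edges length 1.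
    long : ∀ (p : Route ((_∈ₑ S) ∩ (_≢ g)) y x) → 2 ≤ length p
    long ε = ⊥-elim (joins-distinct simple jg refl)
    long ((e , (_ , e≢g) , je) ◅ ε) = ⊥-elim (e≢g (proj₂ simple e g _ _ je (joins-sym jg)))
    long (_ ◅ _ ◅ _) = s≤s (s≤s z≤n)

    edge≢g : ∀ k → edge p k ≢ g
    edge≢g k = proj₂ (edge-∈ p k)

    es-distinct : Injective _≡_ _≡_ es
    es-distinct {i} {j} eq with initOrLast L i | initOrLast L j
    ... | init s | init t = cong inject₁ (edge-injective p d
            (trans (sym (snoc-init (edge p) g s)) (trans eq (snoc-init (edge p) g t))))
    ... | init s | last   = ⊥-elim (edge≢g s
            (trans (sym (snoc-init (edge p) g s)) (trans eq (snoc-last L (edge p) g))))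
    ... | last   | init t = ⊥-elim (edge≢g t
            (trans (sym (snoc-init (edge p) g t)) (trans (sym eq) (snoc-last L (edge p) g))))
    ... | last   | last   = refl

    inS : ∀ j → es j ∈ₑ S
    inS j with initOrLast L j
    ... | init s = subst (_∈ₑ S) (sym (snoc-init (edge p) g s)) (proj₁ (edge-∈ p s))
    ... | last   = subst (_∈ₑ S) (sym (snoc-last L (edge p) g)) g∈S

    cycle : Cycle G S
    cycle = record
      { l = L ; long = long p ; vs = vertex p ; es = es
      ; vs-distinct = vertex-injective p d ; es-distinct = es-distinct ; inS = inS
      ; joins = λ s → subst (λ e → Joins G e (vertex p (inject₁ s)) (vertex p (suc s)))
                          (sym (snoc-init (edge p) g s)) (edge-joins p s)
      ; closes = subst₂ (Joins G (es (fromℕ L))) (sym (vertex-last p)) (sym (vertex-first p))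
                   (subst (λ e → Joins G e x y) (sym (snoc-last L (edge p) g)) jg) }

module ColourClasses (G : Graph) where
  open Routes G
  open Cycles G
  open CycleRoutes G

  -- A colour class is given by its edge set P and the flags marking which of
  -- its edges are surplus; for a partition this is definitionally (Mset p, Pᵢ p i).
  surplusPart forestPart : EdgeSet G → EdgeSet G → EdgeSet G
  surplusPart flag P e = if flag e then P e else false
  forestPart  flag P e = if flag e then false else P e

  ValidClass : EdgeSet G → EdgeSet G → Set
  ValidClass flag P =
    Forest G (forestPart flag P) × Pseudoforest G P × PMatching G P (surplusPart flag P)

  surplusPart-∈ : ∀ flag P {e} → e ∈ₑ surplusPart flag P → flag e ≡ true × e ∈ₑ P
  surplusPart-∈ flag P {e} e∈M with flag e
  ... | true = refl , e∈M

  forestPart-∈ : ∀ flag P {e} → e ∈ₑ forestPart flag P → flag e ≡ false × e ∈ₑ P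
  forestPart-∈ flag P {e} e∈F with flag e
  ... | false = refl , e∈F

  surplusPart-intro : ∀ flag P {e} → flag e ≡ true → e ∈ₑ P → e ∈ₑ surplusPart flag P
  surplusPart-intro flag P flag-e e∈P rewrite flag-e = e∈P

  forestPart-intro : ∀ flag P {e} → flag e ≡ false → e ∈ₑ P → e ∈ₑ forestPart flag P
  forestPart-intro flag P flag-e e∈P rewrite flag-e = e∈P

  private
    guarded-cong : ∀ {f f' x x' : Bool} → x ≡ x' → (x ≡ true → f ≡ f') →
                   (if f then x else false) ≡ (if f' then x' else false) ×
                   (if f then false else x) ≡ (if f' then false else x')
    guarded-cong {x = true}  refl agree rewrite agree refl = refl , refl
    guarded-cong {false} {false} {false} refl _ = refl , refl
    guarded-cong {false} {true}  {false} refl _ = refl , refl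
    guarded-cong {true}  {false} {false} refl _ = refl , refl
    guarded-cong {true}  {true}  {false} refl _ = refl , refl

  validClass-resp : ∀ {flag flag' P P'} → (∀ e → P e ≡ P' e) → (∀ e → e ∈ₑ P → flag e ≡ flag' e) →
                    ValidClass flag P → ValidClass flag' P'
  validClass-resp {flag} {flag'} {P} {P'} P≗P' agree (forest , pseudo , M⊆P , unique , onCycle) =
      (λ C → forest (cycle-⊆ (from (proj₂ ∘ parts)) C))
    , (λ C D c e → pseudo (cycle-⊆ (from P≗P') C) (cycle-⊆ (from P≗P') D)
                          (route⇒connected (mapRoute (from P≗P') (connected⇒route c))) e)
    , (λ e e∈M → to P≗P' (M⊆P e (from (proj₁ ∘ parts) e∈M)))
    , (λ C → let ((j , Mj) , uniq) = unique (cycle-⊆ (from P≗P') C)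
             in (j , to (proj₁ ∘ parts) Mj) ,
                λ j j' Mj Mj' → uniq j j' (from (proj₁ ∘ parts) Mj) (from (proj₁ ∘ parts) Mj'))
    , (λ e e∈M → let (D , onD) = onCycle e (from (proj₁ ∘ parts) e∈M) in cycle-⊆ (to P≗P') D , onD)
    where
    parts : ∀ e → surplusPart flag P e ≡ surplusPart flag' P' e × forestPart flag P e ≡ forestPart flag' P' e
    parts e = guarded-cong {flag e} {flag' e} (P≗P' e) (agree e)

    to : ∀ {S S' : EdgeSet G} → (∀ e → S e ≡ S' e) → (_∈ₑ S) ⊆ (_∈ₑ S')
    to S≗S' {e} e∈S = trans (sym (S≗S' e)) e∈S

    from : ∀ {S S' : EdgeSet G} → (∀ e → S e ≡ S' e) → (_∈ₑ S') ⊆ (_∈ₑ S)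
    from S≗S' {e} e∈S' = trans (S≗S' e) e∈S'

  module ValidClassFacts {flag P : EdgeSet G} (valid : ValidClass flag P) where

    forest : Forest G (forestPart flag P)
    forest = proj₁ valid

    pseudoforest : Pseudoforest G P
    pseudoforest = proj₁ (proj₂ valid)

    surplusPerCycle : ∀ (C : Cycle G P) → (∃ λ j → Cycle.es C j ∈ₑ surplusPart flag P) ×
                      (∀ j j' → Cycle.es C j ∈ₑ surplusPart flag P → Cycle.es C j' ∈ₑ surplusPart flag P → j ≡ j')
    surplusPerCycle = proj₁ (proj₂ (proj₂ (proj₂ valid)))

    surplusOnCycle : ∀ e → e ∈ₑ surplusPart flag P → Σ (Cycle G P) λ C → OnCycle C e
    surplusOnCycle = proj₂ (proj₂ (proj₂ (proj₂ valid)))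

    onCycle-surplus-unique : ∀ (D : Cycle G P) {e e'} → OnCycle D e → OnCycle D e' →
                             e ∈ₑ surplusPart flag P → e' ∈ₑ surplusPart flag P → e ≡ e'
    onCycle-surplus-unique D (s , refl) (t , refl) e∈M e'∈M =
      cong (Cycle.es D) (proj₂ (surplusPerCycle D) s t e∈M e'∈M)

    surplus-cycle : ∀ {a w z} → a ∈ₑ surplusPart flag P → Joins G a w z →
                    Σ (Cycle G P) λ A → OnCycle A a × Route (_∈ₑ P) w (Cycle.vs A zero)
    surplus-cycle a∈M ja =
      let (A , j , eq) = surplusOnCycle _ a∈M
      in A , (j , eq) , reverseRoute (mapRoute (onCycle-∈ A) (toEnd A j eq ja))

    surplus-on-cycle : ∀ {a w z} → a ∈ₑ surplusPart flag P → Joins G a w z →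
                       (D : Cycle G P) → Route (_∈ₑ P) (Cycle.vs D zero) w → OnCycle D a
    surplus-on-cycle a∈M ja D r =
      let (A , a∈A , toA) = surplus-cycle a∈M ja
      in proj₂ (pseudoforest D A (route⇒connected (r ◅◅ toA)) _) a∈A

    surplus-unique : ∀ {a h w z u v} → a ∈ₑ surplusPart flag P → h ∈ₑ surplusPart flag P →
                     Joins G a w z → Joins G h u v → Route (_∈ₑ P) u w → h ≡ a
    surplus-unique a∈M h∈M ja jh r =
      let (D , s , eqh) = surplusOnCycle _ h∈M
          toU = mapRoute (onCycle-∈ D) (toEnd D s eqh jh)
      in onCycle-surplus-unique D (s , eqh) (surplus-on-cycle a∈M ja D (toU ◅◅ r)) h∈M a∈M

  open ValidClassFacts public

  module Exchange (simple : Simple G) {flag P : EdgeSet G} (valid : ValidClass flag P)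
                  {a b : E} (a∈M : a ∈ₑ surplusPart flag P) (b∉P : P b ≡ false)
                  {w z x : V} (ja : Joins G a w z) (jb : Joins G b x w) where

    P-a : Pred E 0ℓ
    P-a = (_∈ₑ P) ∩ (_≢ a)

    closes? : Dec (Route P-a x w)
    closes? = reachable? (λ e → (P e Bool.≟ true) ×-dec ¬? (e ≟ a)) w x

    closingRoute : does closes? ≡ true → Route P-a x w
    closingRoute closes with closes?
    ... | yes r = r
    ... | no _  = ⊥-elim (false≢true closes)

    module _ {flag' P' : EdgeSet G} (a∉P' : P' a ≡ false) (b∈P' : b ∈ₑ P')
             (P'-keeps : ∀ e → e ≢ a → e ≢ b → P' e ≡ P e)
             (flag'-b : flag' b ≡ does closes?)
             (flag'-keeps : ∀ e → e ≢ a → e ≢ b → flag' e ≡ flag e) where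

      private
        onCycle? : ∀ {S} (C : Cycle G S) e → Dec (OnCycle C e)
        onCycle? C e = any? (λ j → Cycle.es C j ≟ e)

        ∈P⇒≢b : ∀ {e} → e ∈ₑ P → e ≢ b
        ∈P⇒≢b e∈P refl = false≢true (trans (sym b∉P) e∈P)

        P'⊆P-a∪b : (_∈ₑ P') ⊆ P-a ∪ (_≡ b)
        P'⊆P-a∪b {e} e∈P' with e ≟ b | e ≟ a
        ... | yes e≡b | _        = inj₂ e≡b
        ... | no _    | yes refl = ⊥-elim (false≢true (trans (sym a∉P') e∈P'))
        ... | no e≢b  | no e≢a   = inj₁ (trans (sym (P'-keeps e e≢a e≢b)) e∈P' , e≢a)

        P'⊆P∪b : (_∈ₑ P') ⊆ (_∈ₑ P) ∪ (_≡ b)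
        P'⊆P∪b e∈P' = Sum.map₁ proj₁ (P'⊆P-a∪b e∈P')

        P'-b⊆P-a : ∀ {e} → e ∈ₑ P' → e ≢ b → P-a e
        P'-b⊆P-a e∈P' e≢b with P'⊆P-a∪b e∈P'
        ... | inj₁ e∈P-a = e∈P-a
        ... | inj₂ e≡b   = ⊥-elim (e≢b e≡b)

        P-a⊆P' : P-a ⊆ (_∈ₑ P')
        P-a⊆P' {e} (e∈P , e≢a) = trans (P'-keeps e e≢a (∈P⇒≢b e∈P)) e∈P

        surplus-agree : ∀ {e} → e ∈ₑ P' → e ≢ b → surplusPart flag' P' e ≡ surplusPart flag P e
        surplus-agree {e} e∈P' e≢b =
          let (_ , e≢a) = P'-b⊆P-a e∈P' e≢b
          in cong₂ (λ f q → if f then q else false) (flag'-keeps e e≢a e≢b) (P'-keeps e e≢a e≢b)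

        liftRoute : Route P-a x w → ∀ {u v} → Route (_∈ₑ P') u v → Route (_∈ₑ P) u v
        liftRoute r r' = mapRoute proj₁ (bypass P'⊆P-a∪b jb r r')

        aroundB : ∀ {S} → (_∈ₑ S) ⊆ (_∈ₑ P') → (C : Cycle G S) → ∀ j → Cycle.es C j ≡ b →
                  Route P-a x w
        aroundB S⊆P' C j eq =
          mapRoute (λ (onC , ≢es-j) → P'-b⊆P-a (S⊆P' (onCycle-∈ C onC)) (λ e≡b → ≢es-j (trans e≡b (sym eq))))
            (around C j (subst (λ e → Joins G e x w) (sym eq) jb))

        startToW : (C : Cycle G P') → ∀ j → Cycle.es C j ≡ b → Route (_∈ₑ P') (Cycle.vs C zero) w
        startToW C j eq = mapRoute (onCycle-∈ C) (toEnd C j eq (joins-sym jb))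

        asCycleOfP : (C : Cycle G P') → ¬ OnCycle C b → Cycle G P
        asCycleOfP C b∉C = cycle-within C λ j → proj₁ (P'-b⊆P-a (Cycle.inS C j) (λ eq → b∉C (j , eq)))

        -- A b-free cycle of P' is a cycle of P avoiding a, so it lies outside the component of a.
        far-from-w : (C : Cycle G P') → ¬ OnCycle C b → ¬ Route (_∈ₑ P) (Cycle.vs C zero) w
        far-from-w C b∉C r =
          let (j , eq) = surplus-on-cycle valid a∈M ja (asCycleOfP C b∉C) r
          in proj₂ (P'-b⊆P-a (Cycle.inS C j) (λ eq' → b∉C (j , eq'))) eq

        forest' : Forest G (forestPart flag' P')
        forest' C with onCycle? C b
        ... | yes (j , eq) =
          let b∈F' = subst (_∈ₑ forestPart flag' P') eq (Cycle.inS C j)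
              r = aroundB (λ e∈F' → proj₂ (forestPart-∈ flag' P' e∈F')) C j eq
          in false≢true (trans (sym (proj₁ (forestPart-∈ flag' P' b∈F'))) (trans flag'-b (dec-true closes? r)))
        ... | no b∉C = forest valid (cycle-within C λ j → inF (Cycle.inS C j) (λ eq → b∉C (j , eq)))
          where
          inF : ∀ {e} → e ∈ₑ forestPart flag' P' → e ≢ b → e ∈ₑ forestPart flag P
          inF {e} e∈F' e≢b =
            let (flag'-e , e∈P') = forestPart-∈ flag' P' e∈F'
                (e∈P , e≢a) = P'-b⊆P-a e∈P' e≢b
            in forestPart-intro flag P (trans (sym (flag'-keeps e e≢a e≢b)) flag'-e) e∈P

        matching' : PMatching G P' (surplusPart flag' P')
        matching' = (λ _ e∈M' → proj₂ (surplusPart-∈ flag' P' e∈M')) , oneOnEach , onSomeCycle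
          where
          oneOnEach : ∀ (C : Cycle G P') → (∃ λ j → Cycle.es C j ∈ₑ surplusPart flag' P') ×
                      (∀ j j' → Cycle.es C j ∈ₑ surplusPart flag' P' → Cycle.es C j' ∈ₑ surplusPart flag' P' → j ≡ j')
          oneOnEach C with onCycle? C b
          ... | yes (j , eq) =
                (j , subst (_∈ₑ surplusPart flag' P') (sym eq) (surplusPart-intro flag' P' (trans flag'-b (dec-true closes? r)) b∈P'))
              , λ s t Ms Mt → Cycle.es-distinct C (trans (isB s Ms) (sym (isB t Mt)))
            where
            r : Route P-a x w
            r = aroundB (λ e∈P' → e∈P') C j eq

            -- Any other surplus edge of C would be a surplus edge of P in the component of a.
            isB : ∀ s → Cycle.es C s ∈ₑ surplusPart flag' P' → Cycle.es C s ≡ b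
            isB s Ms with Cycle.es C s ≟ b
            ... | yes es≡b = es≡b
            ... | no es≢b = ⊥-elim (proj₂ (P'-b⊆P-a e∈P' es≢b) (surplus-unique valid a∈M e∈M ja (inj₁ refl) toW))
              where
              e∈P' : Cycle.es C s ∈ₑ P'
              e∈P' = proj₂ (surplusPart-∈ flag' P' Ms)

              e∈M : Cycle.es C s ∈ₑ surplusPart flag P
              e∈M = trans (sym (surplus-agree e∈P' es≢b)) Ms

              toW : Route (_∈ₑ P) (proj₁ (ends G (Cycle.es C s))) w
              toW = liftRoute r (reverseRoute (mapRoute (onCycle-∈ C) (toEnd C s refl (inj₁ refl))) ◅◅ startToW C j eq)
          ... | no b∉C =
            let ((j , Mj) , uniq) = surplusPerCycle valid (asCycleOfP C b∉C)
                agree : ∀ j → surplusPart flag' P' (Cycle.es C j) ≡ surplusPart flag P (Cycle.es C j)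
                agree j = surplus-agree (Cycle.inS C j) (λ eq → b∉C (j , eq))
            in (j , trans (agree j) Mj) , λ s t Ms Mt → uniq s t (trans (sym (agree s)) Ms) (trans (sym (agree t)) Mt)

          onSomeCycle : ∀ e → e ∈ₑ surplusPart flag' P' → Σ (Cycle G P') λ C → OnCycle C e
          onSomeCycle e e∈M' with e ≟ b
          ... | yes refl =
            let flag'-b≡true = proj₁ (surplusPart-∈ flag' P' e∈M')
                r = closingRoute (trans (sym flag'-b) flag'-b≡true)
            in closeCycle simple P' b∈P' jb (reverseRoute (mapRoute (λ q → P-a⊆P' q , ∈P⇒≢b (proj₁ q)) r))
          ... | no e≢b =
            let e∈P' = proj₂ (surplusPart-∈ flag' P' e∈M')
                e∈M = trans (sym (surplus-agree e∈P' e≢b)) e∈M'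
                (e∈P , e≢a) = P'-b⊆P-a e∈P' e≢b
                (D , e∈D) = surplusOnCycle valid e e∈M
                a∉D : ∀ t → Cycle.es D t ≢ a
                a∉D t eqa = e≢a (onCycle-surplus-unique valid D e∈D (t , eqa) e∈M a∈M)
            in cycle-within D (λ t → P-a⊆P' (Cycle.inS D t , a∉D t)) , e∈D

        P∖a : EdgeSet G
        P∖a e = if ⌊ e ≟ a ⌋ then false else P e

        P∖a⊆P-a : (_∈ₑ P∖a) ⊆ P-a
        P∖a⊆P-a {e} e∈P∖a with e ≟ a
        ... | no e≢a = e∈P∖a , e≢a

        P-a⊆P∖a : P-a ⊆ (_∈ₑ P∖a)
        P-a⊆P∖a {e} (e∈P , e≢a) with e ≟ a
        ... | yes e≡a = ⊥-elim (e≢a e≡a)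
        ... | no _    = e∈P

        -- The cycle closed by g avoids a, so it lies outside the component of a.
        a-free-closure-far : ∀ {g u v} → g ∈ₑ P∖a → Joins G g u v →
                             Route ((_∈ₑ P∖a) ∩ (_≢ g)) v u → ¬ Route (_∈ₑ P) u w
        a-free-closure-far g∈P∖a jg r u→w =
          let (K₀ , s , eqs) = closeCycle simple P∖a g∈P∖a jg r
              K = cycle-within K₀ λ t → proj₁ (P∖a⊆P-a (Cycle.inS K₀ t))
              start→u = mapRoute (λ onK → proj₁ (P∖a⊆P-a (onCycle-∈ K₀ onK))) (toEnd K₀ s eqs jg)
              (t , eqt) = surplus-on-cycle valid a∈M ja K (start→u ◅◅ u→w)
          in proj₂ (P∖a⊆P-a (Cycle.inS K₀ t)) eqt

        -- If g lay on C only, then C − g together with D − b would join the ends of g in P − a − g.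
        same-cycle : (C D : Cycle G P') → OnCycle C b → OnCycle D b → ∀ {g} → OnCycle C g → OnCycle D g
        same-cycle C D (jC , eqC) (jD , eqD) {g} (jg , eqg) with onCycle? D g | g ≟ b
        ... | yes g∈D | _        = g∈D
        ... | no _    | yes refl = jD , eqD
        ... | no g∉D  | no g≢b   =
          ⊥-elim (a-free-closure-far (P-a⊆P∖a (P'-b⊆P-a (onCycle-∈ C (jg , eqg)) g≢b)) jg'
                    (reverseRoute (bypass C-g⊆Q∪b jb D-b C-g)) u→w)
          where
          u v : V
          u = proj₁ (ends G g)
          v = proj₂ (ends G g)

          jg' : Joins G g u v
          jg' = inj₁ refl

          Q : Pred E 0ℓ
          Q = (_∈ₑ P∖a) ∩ (_≢ g)

          C-g : Route (Avoiding C jg) u v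
          C-g = around C jg (subst (λ e → Joins G e u v) (sym eqg) jg')

          C-g⊆Q∪b : Avoiding C jg ⊆ Q ∪ (_≡ b)
          C-g⊆Q∪b {e} (onC , e≢g) with e ≟ b
          ... | yes e≡b = inj₂ e≡b
          ... | no e≢b  = inj₁ (P-a⊆P∖a (P'-b⊆P-a (onCycle-∈ C onC) e≢b) , λ e≡g → e≢g (trans e≡g (sym eqg)))

          D-b : Route Q x w
          D-b = mapRoute (λ (onD , ≢es-jD) →
                    P-a⊆P∖a (P'-b⊆P-a (onCycle-∈ D onD) (λ e≡b → ≢es-jD (trans e≡b (sym eqD))))
                  , λ { refl → g∉D onD })
                  (around D jD (subst (λ e → Joins G e x w) (sym eqD) jb))

          u→w : Route (_∈ₑ P) u w
          u→w = liftRoute (aroundB (λ e∈P' → e∈P') C jC eqC)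
                  (reverseRoute (mapRoute (onCycle-∈ C) (toEnd C jg eqg jg')) ◅◅ startToW C jC eqC)

        pseudo' : Pseudoforest G P'
        pseudo' C D c e with onCycle? C b | onCycle? D b
        ... | yes b∈C | yes b∈D = same-cycle C D b∈C b∈D , same-cycle D C b∈D b∈C
        ... | yes (j , eq) | no b∉D = ⊥-elim (far-from-w D b∉D
              (liftRoute (aroundB (λ e∈P' → e∈P') C j eq) (reverseRoute (connected⇒route c) ◅◅ startToW C j eq)))
        ... | no b∉C | yes (j , eq) = ⊥-elim (far-from-w C b∉C
              (liftRoute (aroundB (λ e∈P' → e∈P') D j eq) (connected⇒route c ◅◅ startToW D j eq)))
        ... | no b∉C | no b∉D with split P'⊆P∪b jb (connected⇒route c)
        ...   | inj₁ r                 = pseudoforest valid (asCycleOfP C b∉C) (asCycleOfP D b∉D) (route⇒connected r) e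
        ...   | inj₂ (inj₁ (_ , w→D))  = ⊥-elim (far-from-w D b∉D (reverseRoute w→D))
        ...   | inj₂ (inj₂ (C→w , _))  = ⊥-elim (far-from-w C b∉C C→w)

      exchange-valid : ValidClass flag' P'
      exchange-valid = forest' , pseudo' , matching'

indicator-mono : ∀ {a b : Bool} → (a ≡ true → b ≡ true) → (if a then 1 else 0) ≤ (if b then 1 else 0)
indicator-mono {false} _   = z≤n
indicator-mono {true}  a⇒b rewrite a⇒b refl = s≤s z≤n

count-mono : ∀ {m} (f g : Fin m → Bool) → (∀ e → f e ≡ true → g e ≡ true) → count f ≤ count g
count-mono {zero}  f g f⊆g = z≤n
count-mono {suc m} f g f⊆g =
  ℕ.+-mono-≤ (indicator-mono (f⊆g zero)) (count-mono (f ∘ suc) (g ∘ suc) (f⊆g ∘ suc))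

count-strict : ∀ {m} (f g : Fin m → Bool) → (∀ e → f e ≡ true → g e ≡ true) →
               ∀ e → f e ≡ false → g e ≡ true → count f < count g
count-strict {suc m} f g f⊆g zero fe ge rewrite fe | ge =
  ℕ.+-mono-<-≤ (s≤s z≤n) (count-mono (f ∘ suc) (g ∘ suc) (f⊆g ∘ suc))
count-strict {suc m} f g f⊆g (suc e) fe ge =
  ℕ.+-mono-≤-< (indicator-mono (f⊆g zero)) (count-strict (f ∘ suc) (g ∘ suc) (f⊆g ∘ suc) e fe ge)

module Shortening (G : Graph) (simple : Simple G) (k : ℕ) where
  open Routes G
  open ColourClasses G

  private
    ≟-refl : ∀ (x : Fin k) → ⌊ x ≟ x ⌋ ≡ true
    ≟-refl x = trans (isYes≗does (x ≟ x)) (dec-true (x ≟ x) refl)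

    ≟-≢ : ∀ {x y : Fin k} → x ≢ y → ⌊ x ≟ y ⌋ ≡ false
    ≟-≢ {x} {y} x≢y = trans (isYes≗does (x ≟ y)) (dec-false (x ≟ y) x≢y)

    ≟-≡ : ∀ {x y : Fin k} → ⌊ x ≟ y ⌋ ≡ true → x ≡ y
    ≟-≡ {x} {y} h with x ≟ y
    ... | yes x≡y = x≡y
    ... | no _    = ⊥-elim (false≢true h)

  setTwo : ∀ {A : Set} → (E → A) → E → A → E → A → E → A
  setTwo f e₁ x₁ e₂ x₂ = updateAt (updateAt f e₁ (const x₁)) e₂ (const x₂)

  module _ {A : Set} (f : E → A) {e₁ e₂ : E} (x₁ x₂ : A) where

    setTwo-first : e₁ ≢ e₂ → setTwo f e₁ x₁ e₂ x₂ e₁ ≡ x₁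
    setTwo-first e₁≢e₂ = trans (updateAt-minimal e₁ e₂ _ e₁≢e₂) (updateAt-updates e₁ f)

    setTwo-second : setTwo f e₁ x₁ e₂ x₂ e₂ ≡ x₂
    setTwo-second = updateAt-updates e₂ _

    setTwo-other : ∀ {e} → e ≢ e₁ → e ≢ e₂ → setTwo f e₁ x₁ e₂ x₂ e ≡ f e
    setTwo-other {e} e≢e₁ e≢e₂ = trans (updateAt-minimal e e₂ _ e≢e₂) (updateAt-minimal e e₁ f e≢e₁)

  record SurplusPath (p : Partition G k) (i : Fin k) (l : ℕ) : Set where
    field
      vs : Fin (suc (suc l)) → V
      es : Fin (suc l) → E
      surplus : ∀ t → es t ∈ₑ Mset p
      joins : ∀ t → Joins G (es t) (vs (inject₁ t)) (vs (suc t))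
      distinct : Injective _≡_ _≡_ vs
      first∈Mᵢ : es zero ∈ₑ Mᵢ p i
      last∈Mᵢ : es (fromℕ l) ∈ₑ Mᵢ p i
      first≢last : es zero ≢ es (fromℕ l)

  Shorter : Partition G k → Set
  Shorter p = Σ (Partition G k) λ p' → Valid p' × sizeM p' < sizeM p

  module Swap {l} {p : Partition G k} (valid : Valid p) {i} (π : SurplusPath p i (suc l)) where
    open Partition p
    open SurplusPath π

    e₁ e₂ f : E
    e₁ = es zero
    e₂ = es (suc zero)
    f  = es (fromℕ (suc l))

    c : Fin k
    c = col e₂

    e₁≢e₂ : e₁ ≢ e₂
    e₁≢e₂ eq with joins-ends (joins zero)
                    (subst (λ e → Joins G e (vs (suc zero)) (vs (suc (suc zero)))) (sym eq) (joins (suc zero)))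
    ... | inj₁ (v₀≡v₁ , _) = case distinct v₀≡v₁ of λ ()
    ... | inj₂ (v₀≡v₂ , _) = case distinct v₀≡v₂ of λ ()

    col-e₁ : col e₁ ≡ i
    col-e₁ = ≟-≡ (proj₂ (surplusPart-∈ inM (Pᵢ p i) first∈Mᵢ))

    col-f : col f ≡ i
    col-f = ≟-≡ (proj₂ (surplusPart-∈ inM (Pᵢ p i) last∈Mᵢ))

    c≢i : c ≢ i
    c≢i c≡i = e₁≢e₂ (sym (surplus-unique (valid i) first∈Mᵢ e₂∈Mᵢ (joins-sym (joins zero)) (joins (suc zero)) ε))
      where
      e₂∈Mᵢ : e₂ ∈ₑ Mᵢ p i
      e₂∈Mᵢ = surplusPart-intro inM (Pᵢ p i) (surplus (suc zero)) (trans (cong (λ x → ⌊ x ≟ i ⌋) c≡i) (≟-refl i))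

    private
      module Xc = Exchange simple (valid c) {a = e₂} {b = e₁}
                    (surplusPart-intro inM (Pᵢ p c) (surplus (suc zero)) (≟-refl c))
                    (trans (cong (λ x → ⌊ x ≟ c ⌋) col-e₁) (≟-≢ (c≢i ∘ sym)))
                    (joins (suc zero)) (joins zero)
      module Xi = Exchange simple (valid i) {a = e₁} {b = e₂} first∈Mᵢ (≟-≢ c≢i)
                    (joins-sym (joins zero)) (joins-sym (joins (suc zero)))

    col' : E → Fin k
    col' = setTwo col e₁ c e₂ i

    inM' : EdgeSet G
    inM' = setTwo inM e₁ (does Xc.closes?) e₂ (does Xi.closes?)

    p' : Partition G k
    p' = record { col = col' ; inM = inM' }

    col'-e₁ : col' e₁ ≡ c
    col'-e₁ = setTwo-first col c i e₁≢e₂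

    col'-e₂ : col' e₂ ≡ i
    col'-e₂ = setTwo-second col c i

    col'-other : ∀ {e} → e ≢ e₁ → e ≢ e₂ → col' e ≡ col e
    col'-other = setTwo-other col c i

    inM'-other : ∀ {e} → e ≢ e₁ → e ≢ e₂ → inM' e ≡ inM e
    inM'-other = setTwo-other inM _ _

    valid' : Valid p'
    valid' x with x ≟ c | x ≟ i
    ... | yes refl | _ =
      Xc.exchange-valid (recoloured col'-e₂ (≟-≢ (c≢i ∘ sym))) (recoloured col'-e₁ (≟-refl c))
        (λ e e≢e₂ e≢e₁ → recoloured (col'-other e≢e₁ e≢e₂) refl)
        (setTwo-first inM _ _ e₁≢e₂) (λ e e≢e₂ e≢e₁ → inM'-other e≢e₁ e≢e₂)
      where
      recoloured : ∀ {e y b} → col' e ≡ y → ⌊ y ≟ c ⌋ ≡ b → Pᵢ p' c e ≡ b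
      recoloured col'e≡y eq = trans (cong (λ z → ⌊ z ≟ c ⌋) col'e≡y) eq
    ... | no _ | yes refl =
      Xi.exchange-valid (recoloured col'-e₁ (≟-≢ c≢i)) (recoloured col'-e₂ (≟-refl i))
        (λ e e≢e₁ e≢e₂ → recoloured (col'-other e≢e₁ e≢e₂) refl)
        (setTwo-second inM _ _) (λ e e≢e₁ e≢e₂ → inM'-other e≢e₁ e≢e₂)
      where
      recoloured : ∀ {e y b} → col' e ≡ y → ⌊ y ≟ i ⌋ ≡ b → Pᵢ p' i e ≡ b
      recoloured col'e≡y eq = trans (cong (λ z → ⌊ z ≟ i ⌋) col'e≡y) eq
    ... | no x≢c | no x≢i = validClass-resp unchanged agree (valid x)
      where
      unchanged : ∀ e → Pᵢ p x e ≡ Pᵢ p' x e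
      unchanged e with e ≟ e₁ | e ≟ e₂
      ... | yes refl | _ = trans (cong (λ z → ⌊ z ≟ x ⌋) col-e₁) (trans (≟-≢ (x≢i ∘ sym))
                             (sym (trans (cong (λ z → ⌊ z ≟ x ⌋) col'-e₁) (≟-≢ (x≢c ∘ sym)))))
      ... | no _ | yes refl = trans (≟-≢ (x≢c ∘ sym)) (sym (trans (cong (λ z → ⌊ z ≟ x ⌋) col'-e₂) (≟-≢ (x≢i ∘ sym))))
      ... | no e≢e₁ | no e≢e₂ = cong (λ z → ⌊ z ≟ x ⌋) (sym (col'-other e≢e₁ e≢e₂))

      agree : ∀ e → e ∈ₑ Pᵢ p x → inM e ≡ inM' e
      agree e e∈P with ≟-≡ e∈P
      ... | refl = sym (inM'-other (λ { refl → x≢i col-e₁ }) (λ { refl → x≢c refl }))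

    inM'⊆inM : ∀ e → inM' e ≡ true → inM e ≡ true
    inM'⊆inM e h with e ≟ e₁ | e ≟ e₂
    ... | yes refl | _        = surplus zero
    ... | no _     | yes refl = surplus (suc zero)
    ... | no e≢e₁  | no e≢e₂  = trans (sym (inM'-other e≢e₁ e≢e₂)) h

    module _ (closes₁ : does Xc.closes? ≡ true) (closes₂ : does Xi.closes? ≡ true) where

      inM'≗inM : ∀ e → inM' e ≡ inM e
      inM'≗inM e with e ≟ e₁ | e ≟ e₂
      ... | yes refl | _ = trans (setTwo-first inM _ _ e₁≢e₂) (trans closes₁ (sym (surplus zero)))
      ... | no _ | yes refl = trans (setTwo-second inM _ _) (trans closes₂ (sym (surplus (suc zero))))
      ... | no e≢e₁ | no e≢e₂ = inM'-other e≢e₁ e≢e₂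

      tail : SurplusPath p' i l
      tail = record
        { vs = vs ∘ suc
        ; es = es ∘ suc
        ; surplus = λ t → trans (inM'≗inM _) (surplus (suc t))
        ; joins = joins ∘ suc
        ; distinct = suc-injective ∘ distinct
        ; first∈Mᵢ = surplusPart-intro inM' (Pᵢ p' i) (trans (setTwo-second inM _ _) closes₂)
                       (trans (cong (λ z → ⌊ z ≟ i ⌋) col'-e₂) (≟-refl i))
        ; last∈Mᵢ = trans (cong₂ (λ b z → if b then ⌊ z ≟ i ⌋ else false)
                      (inM'≗inM f) (col'-other f≢e₁ f≢e₂)) last∈Mᵢ
        ; first≢last = f≢e₂ ∘ sym
        }
        where
        f≢e₁ : f ≢ e₁
        f≢e₁ = first≢last ∘ sym
        f≢e₂ : f ≢ e₂
        f≢e₂ f≡e₂ = c≢i (trans (cong col (sym f≡e₂)) col-f)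

    shorter-or-tail : Shorter p ⊎ Σ (Partition G k) λ p' → Valid p' × sizeM p' ≤ sizeM p × SurplusPath p' i l
    shorter-or-tail with does Xc.closes? in closes₁ | does Xi.closes? in closes₂
    ... | false | _ =
      inj₁ (p' , valid' , count-strict inM' inM inM'⊆inM e₁ (trans (setTwo-first inM _ _ e₁≢e₂) closes₁) (surplus zero))
    ... | true | false =
      inj₁ (p' , valid' , count-strict inM' inM inM'⊆inM e₂ (trans (setTwo-second inM _ _) closes₂) (surplus (suc zero)))
    ... | true | true =
      inj₂ (p' , valid' , count-mono inM' inM inM'⊆inM , tail closes₁ closes₂)

  shorten : ∀ l {p i} → Valid p → SurplusPath p i l → Shorter p
  shorten zero    valid π = ⊥-elim (SurplusPath.first≢last π refl)
  shorten (suc l) valid π with Swap.shorter-or-tail valid π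
  ... | inj₁ shorter = shorter
  ... | inj₂ (p' , valid' , p'≤p , π') =
    let (p'' , valid'' , p''<p') = shorten l valid' π' in p'' , valid'' , ℕ.<-≤-trans p''<p' p'≤p

lemma8 : (G : Graph) → Simple G → (k : ℕ) → (p : Partition G k) → Valid p →
         (π : Path G (Mset p)) → (e f : Fin (m G)) → FirstLast π e f →
         e ≢ f → (i : Fin k) → e ∈ₑ Mᵢ p i → f ∈ₑ Mᵢ p i →
         Σ (Partition G k) λ p' → Valid p' × sizeM p' < sizeM p
lemma8 G simple k p valid
  record { walk = record { vs = vs ; es = es ; inS = inS ; joins = joins } ; distinct = distinct }
  .(es zero) .(es (fromℕ l)) (l , refl , refl , refl) e≢f i e∈Mᵢ f∈Mᵢ =
  Shortening.shorten G simple k l valid record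
    { vs = vs ; es = es ; surplus = inS ; joins = joins ; distinct = distinct
    ; first∈Mᵢ = e∈Mᵢ ; last∈Mᵢ = f∈Mᵢ ; first≢last = e≢f }
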